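{- For any integer $m\ge 4$, $\xi(K_4\square K_m)=4$.
   Context: All graphs are finite, simple, connected and undirected; $d_G(u,v)$ is the shortest-path distance. A set $D\subseteq V(G)$ is a distance-equalizer set of $G$ if for any two vertices $x,y\in V(G)\setminus D$ there is $w\in D$ with $d_G(x,w)=d_G(y,w)$. The equidistant dimension $\xi(G)$ is the minimum cardinality of a distance-equalizer set of $G$. $K_m$ is the complete graph on $m$ vertices. The Cartesian product $G\square H$ has vertex set $V(G)\times V(H)$, with $(g,h)\sim(g',h')$ iff either $g=g'$ and $hh'\in E(H)$, or $h=h'$ and $gg'\in E(G)$. -}

module Defs where

open import Data.Nat using (ℕ; zero; suc; _≤_)
open import Data.Fin using (Fin)
open import Data.List using (List; length)
open import Data.List.Membership.Propositional using (_∈_; _∉_)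
open import Data.List.Relation.Unary.Unique.Propositional using (Unique)
open import Data.Product using (_×_; Σ; ∃; ∃-syntax; _,_)
open import Data.Sum using (_⊎_)
open import Relation.Binary.PropositionalEquality using (_≡_; _≢_)

record Graph : Set₁ where
  field
    V   : Set
    _~_ : V → V → Set

open Graph public

data Walk (G : Graph) : V G → V G → ℕ → Set where
  nil  : ∀ {u} → Walk G u u zero
  cons : ∀ {u v w k} → _~_ G u v → Walk G v w k → Walk G u w (suc k)

Dist : (G : Graph) → V G → V G → ℕ → Set
Dist G u v k = Walk G u v k × (∀ j → Walk G u v j → k ≤ j)

K : ℕ → Graph
K m = record { V = Fin m ; _~_ = λ u v → u ≢ v }

_□_ : Graph → Graph → Graph
G □ H = record
  { V   = V G × V H
  ; _~_ = λ { (g , h) (g' , h') →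
              (g ≡ g' × _~_ H h h') ⊎ (h ≡ h' × _~_ G g g') } }

-- Distance-equalizer set (a finite set of vertices given as a duplicate-free list).
IsDistanceEqualizer : (G : Graph) → List (V G) → Set
IsDistanceEqualizer G D =
  ∀ x y → x ∉ D → y ∉ D → x ≢ y →
  ∃[ w ] (w ∈ D × ∃[ k ] (Dist G x w k × Dist G y w k))

EquidistantDimension : (G : Graph) → ℕ → Set
EquidistantDimension G k =
  (∃[ D ] (Unique D × IsDistanceEqualizer G D × length D ≡ k))
  × (∀ D → Unique D → IsDistanceEqualizer G D → k ≤ length D)

-- In K_p □ K_q the distance from (a, b) to (a', b') is [a ≠ a'] + [b ≠ b'].  Two vertices
-- off a column are both at distance 2 from its vertex in a row avoiding both of theirs, so
-- a column of K_4 □ K_m is a distance-equalizer set.  Three vertices (r₁, c₁), (r₂, c₂),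
-- (r₃, c₃) never are.  If their rows take at most two values a ≠ b and f is a column
-- avoiding theirs, each of them is at distance 1 from one of (a, f), (b, f) and 2 from the
-- other; symmetrically for columns.  Otherwise rows and columns are pairwise distinct, and
-- (r₁, c₂), (r₃, f) are at distances 1, 1, 2 and 2, 2, 1 from them.
module Submission where

open import Defs
open import Data.Bool using (true; false; if_then_else_)
open import Data.Empty using (⊥-elim)
open import Data.Fin using (Fin; zero)
open import Data.Fin.Properties using (_≟_; pigeonhole; <⇒≢; ¬∀⟶∃¬)
open import Data.List using (List; []; _∷_; [_]; length; map; lookup; tabulate)
open import Data.List.Membership.Propositional using (_∈_; _∉_)
open import Data.List.Membership.Propositional.Properties using (∈-tabulate⁺)
open import Data.List.Properties using (map-∘)
open import Data.List.Relation.Binary.Subset.Propositional using (_⊆_)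
open import Data.List.Relation.Unary.All as All using (All; []; _∷_)
open import Data.List.Relation.Unary.All.Properties using (All¬⇒¬Any; ¬Any⇒All¬; anti-mono; map⁻)
open import Data.List.Relation.Unary.Any using (here; there; index; any?)
open import Data.List.Relation.Unary.Any.Properties using (lookup-index)
open import Data.List.Relation.Unary.Unique.Propositional using (Unique)
open import Data.List.Relation.Unary.Unique.Propositional.Properties using (tabulate⁺)
open import Data.Nat using (ℕ; suc; _+_; _≤_; _<_; z≤n; s≤s)
open import Data.Nat.Properties using (≤-refl; ≤-trans; ≤-antisym; +-comm; +-monoˡ-≤; +-monoʳ-≤; +-suc)
open import Data.Product using (_×_; _,_; proj₁; proj₂; ∃₂; ∃-syntax; swap)
open import Data.Sum using (_⊎_; inj₁; inj₂)
open import Function using (_∘_)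
open import Relation.Nullary using (¬_; yes; no; does)
open import Relation.Nullary.Decidable using (dec-true; dec-false)
open import Relation.Binary.PropositionalEquality
  using (_≡_; _≢_; refl; sym; trans; cong; subst; subst₂; ≢-sym)

private
  variable
    n p q : ℕ

length<⇒∃∉ : (xs : List (Fin n)) → length xs < n → ∃[ f ] f ∉ xs
length<⇒∃∉ {n} xs |xs|<n = ¬∀⟶∃¬ n (_∈ xs) (λ f → any? (f ≟_) xs) ¬all∈
  where
  ¬all∈ : ¬ (∀ f → f ∈ xs)
  ¬all∈ all∈ with i , j , i<j , same ← pigeonhole |xs|<n (index ∘ all∈) =
    <⇒≢ i<j (trans (lookup-index (all∈ i))
                   (trans (cong (lookup xs) same) (sym (lookup-index (all∈ j)))))

CoveredByTwo : {A : Set} → List A → Set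
CoveredByTwo xs = ∃₂ λ a b → a ≢ b × All (λ x → x ≡ a ⊎ x ≡ b) xs

pair-coveredByTwo : 2 ≤ n → (a b : Fin n) → CoveredByTwo (a ∷ b ∷ [])
pair-coveredByTwo 2≤n a b with a ≟ b
... | no a≢b = a , b , a≢b , inj₁ refl ∷ inj₂ refl ∷ []
... | yes refl with c , c∉ ← length<⇒∃∉ [ a ] 2≤n =
  a , c , (λ a≡c → c∉ (here (sym a≡c))) , inj₁ refl ∷ inj₁ refl ∷ []

distinct⊎coveredByTwo : 2 ≤ n → (a b c : Fin n) →
                        (a ≢ b × a ≢ c × b ≢ c) ⊎ CoveredByTwo (a ∷ b ∷ c ∷ [])
distinct⊎coveredByTwo 2≤n a b c with a ≟ b | a ≟ c | b ≟ c
... | yes refl | _ | _ with x , y , x≢y , pa ∷ pc ∷ [] ← pair-coveredByTwo 2≤n a c =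
  inj₂ (x , y , x≢y , pa ∷ pa ∷ pc ∷ [])
... | no _ | yes refl | _ with x , y , x≢y , pa ∷ pb ∷ [] ← pair-coveredByTwo 2≤n a b =
  inj₂ (x , y , x≢y , pa ∷ pb ∷ pa ∷ [])
... | no _ | no _ | yes refl with x , y , x≢y , pa ∷ pb ∷ [] ← pair-coveredByTwo 2≤n a b =
  inj₂ (x , y , x≢y , pa ∷ pb ∷ pb ∷ [])
... | no a≢b | no a≢c | no b≢c = inj₁ (a≢b , a≢c , b≢c)

differ : Fin n → Fin n → ℕ
differ a b = if does (a ≟ b) then 0 else 1

differ-refl : (a : Fin n) → differ a a ≡ 0
differ-refl a = cong (if_then 0 else 1) (dec-true (a ≟ a) refl)

differ-≢ : {a b : Fin n} → a ≢ b → differ a b ≡ 1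
differ-≢ {a = a} {b} a≢b = cong (if_then 0 else 1) (dec-false (a ≟ b) a≢b)

differ≤1 : (a b : Fin n) → differ a b ≤ 1
differ≤1 a b with does (a ≟ b)
... | true = z≤n
... | false = ≤-refl

hamming : Fin p × Fin q → Fin p × Fin q → ℕ
hamming (a , b) (a' , b') = differ a a' + differ b b'

hamming-swap : (u w : Fin p × Fin q) → hamming (swap u) (swap w) ≡ hamming u w
hamming-swap (a , b) (a' , b') = +-comm (differ b b') (differ a a')

hamming-≡≢ : (a : Fin p) {b b' : Fin q} → b ≢ b' → hamming (a , b) (a , b') ≡ 1
hamming-≡≢ a b≢b' rewrite differ-refl a | differ-≢ b≢b' = refl

hamming-≢≡ : {a a' : Fin p} (b : Fin q) → a ≢ a' → hamming (a , b) (a' , b) ≡ 1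
hamming-≢≡ b a≢a' rewrite differ-≢ a≢a' | differ-refl b = refl

hamming-≢≢ : {a a' : Fin p} {b b' : Fin q} → a ≢ a' → b ≢ b' → hamming (a , b) (a' , b') ≡ 2
hamming-≢≢ a≢a' b≢b' rewrite differ-≢ a≢a' | differ-≢ b≢b' = refl

module _ {p q : ℕ} where

  private
    G : Graph
    G = K p □ K q

  walk-hamming : (u w : Fin p × Fin q) → Walk G u w (hamming u w)
  walk-hamming (a , b) (a' , b') with a ≟ a' | b ≟ b'
  ... | yes refl | yes refl = nil
  ... | yes refl | no b≢b'  = cons (inj₁ (refl , b≢b')) nil
  ... | no a≢a'  | yes refl = cons (inj₂ (refl , a≢a')) nil
  ... | no a≢a'  | no b≢b'  = cons (inj₁ (refl , b≢b')) (cons (inj₂ (refl , a≢a')) nil)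

  hamming-step : ∀ {u v} (w : Fin p × Fin q) → _~_ G u v → hamming u w ≤ suc (hamming v w)
  hamming-step {a , b} {.a , b'} (a' , b'') (inj₁ (refl , _)) =
    subst (differ a a' + differ b b'' ≤_) (+-suc (differ a a') (differ b' b''))
          (+-monoʳ-≤ (differ a a') (≤-trans (differ≤1 b b'') (s≤s z≤n)))
  hamming-step {a , b} {a'' , .b} (a' , b') (inj₂ (refl , _)) =
    +-monoˡ-≤ (differ b b') (≤-trans (differ≤1 a a') (s≤s z≤n))

  hamming≤walk : ∀ {u w j} → Walk G u w j → hamming u w ≤ j
  hamming≤walk {u} nil rewrite differ-refl (proj₁ u) | differ-refl (proj₂ u) = z≤n
  hamming≤walk {w = w} (cons u~v walk) = ≤-trans (hamming-step w u~v) (s≤s (hamming≤walk walk))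

  hamming≡⇒dist : ∀ {u w k} → hamming u w ≡ k → Dist G u w k
  hamming≡⇒dist {u} {w} refl = walk-hamming u w , λ _ → hamming≤walk

  dist⇒≡hamming : ∀ {u w k} → Dist G u w k → k ≡ hamming u w
  dist⇒≡hamming {u} {w} (walk , shortest) =
    ≤-antisym (shortest _ (walk-hamming u w)) (hamming≤walk walk)

SeparatedAt : (x y w : Fin p × Fin q) → Set
SeparatedAt x y w = x ≢ w × y ≢ w × hamming x w ≢ hamming y w

SeparatingPair : List (Fin p × Fin q) → Set
SeparatingPair D = ∃₂ λ x y → x ≢ y × All (SeparatedAt x y) D

separatingPair⇒¬distanceEqualizer : {D : List (Fin p × Fin q)} →
                                    SeparatingPair D → ¬ IsDistanceEqualizer (K p □ K q) D
separatingPair⇒¬distanceEqualizer (x , y , x≢y , separated) equalizer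
  with w , w∈D , _ , dist-x , dist-y ←
       equalizer x y (All¬⇒¬Any (All.map proj₁ separated))
                     (All¬⇒¬Any (All.map (proj₁ ∘ proj₂) separated)) x≢y =
  proj₂ (proj₂ (All.lookup separated w∈D))
        (trans (sym (dist⇒≡hamming dist-x)) (dist⇒≡hamming dist-y))

separatingPair-⊆ : {xs ys : List (Fin p × Fin q)} → xs ⊆ ys → SeparatingPair ys → SeparatingPair xs
separatingPair-⊆ xs⊆ys (x , y , x≢y , separated) = x , y , x≢y , anti-mono xs⊆ys separated

separatedAt-swap : {x y w : Fin p × Fin q} → SeparatedAt x y w → SeparatedAt (swap x) (swap y) (swap w)
separatedAt-swap {x = x} {y} {w} (x≢w , y≢w , distances) =
  x≢w ∘ cong swap , y≢w ∘ cong swap ,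
  subst₂ _≢_ (sym (hamming-swap x w)) (sym (hamming-swap y w)) distances

separatingPair-swap : {D : List (Fin p × Fin q)} → SeparatingPair (map swap D) → SeparatingPair D
separatingPair-swap (x , y , x≢y , separated) =
  swap x , swap y , x≢y ∘ cong swap , All.map separatedAt-swap (map⁻ separated)

rowsCoveredByTwo⇒separatingPair : {D : List (Fin p × Fin q)} →
  CoveredByTwo (map proj₁ D) → ∃[ f ] f ∉ map proj₂ D → SeparatingPair D
rowsCoveredByTwo⇒separatingPair {D = D} (a , b , a≢b , covered) (f , f∉) =
  (a , f) , (b , f) , a≢b ∘ cong proj₁ ,
  All.zipWith separated (map⁻ covered , map⁻ (¬Any⇒All¬ (map proj₂ D) f∉))
  where
  separated : ∀ {w} → (proj₁ w ≡ a ⊎ proj₁ w ≡ b) × f ≢ proj₂ w → SeparatedAt (a , f) (b , f) w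
  separated {r , c} (inj₁ refl , f≢c) =
    f≢c ∘ cong proj₂ , f≢c ∘ cong proj₂ ,
    subst₂ _≢_ (sym (hamming-≡≢ r f≢c)) (sym (hamming-≢≢ (≢-sym a≢b) f≢c)) λ ()
  separated {r , c} (inj₂ refl , f≢c) =
    f≢c ∘ cong proj₂ , f≢c ∘ cong proj₂ ,
    subst₂ _≢_ (sym (hamming-≢≢ a≢b f≢c)) (sym (hamming-≡≢ r f≢c)) λ ()

columnsCoveredByTwo⇒separatingPair : {D : List (Fin p × Fin q)} →
  CoveredByTwo (map proj₂ D) → ∃[ g ] g ∉ map proj₁ D → SeparatingPair D
columnsCoveredByTwo⇒separatingPair {D = D} covered (g , g∉) =
  separatingPair-swap (rowsCoveredByTwo⇒separatingPair
    (subst CoveredByTwo (map-∘ {g = proj₁} {f = swap} D) covered)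
    (g , subst (g ∉_) (map-∘ {g = proj₂} {f = swap} D) g∉))

transversal⇒separatingPair :
  {r₁ r₂ r₃ : Fin p} {c₁ c₂ c₃ f : Fin q} →
  r₁ ≢ r₂ → r₁ ≢ r₃ → r₂ ≢ r₃ → c₁ ≢ c₂ → c₂ ≢ c₃ → f ∉ c₁ ∷ c₂ ∷ c₃ ∷ [] →
  SeparatingPair ((r₁ , c₁) ∷ (r₂ , c₂) ∷ (r₃ , c₃) ∷ [])
transversal⇒separatingPair {r₁ = r₁} {r₂} {r₃} {c₁} {c₂} {c₃} {f}
                           r₁≢r₂ r₁≢r₃ r₂≢r₃ c₁≢c₂ c₂≢c₃ f∉
  with f≢c₁ ∷ f≢c₂ ∷ f≢c₃ ∷ [] ← ¬Any⇒All¬ _ f∉ =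
  (r₁ , c₂) , (r₃ , f) , r₁≢r₃ ∘ cong proj₁ ,
  ( ≢-sym c₁≢c₂ ∘ cong proj₂ , ≢-sym r₁≢r₃ ∘ cong proj₁ ,
    subst₂ _≢_ (sym (hamming-≡≢ r₁ (≢-sym c₁≢c₂))) (sym (hamming-≢≢ (≢-sym r₁≢r₃) f≢c₁)) (λ ()))
  ∷ ( r₁≢r₂ ∘ cong proj₁ , ≢-sym r₂≢r₃ ∘ cong proj₁ ,
    subst₂ _≢_ (sym (hamming-≢≡ c₂ r₁≢r₂)) (sym (hamming-≢≢ (≢-sym r₂≢r₃) f≢c₂)) (λ ()))
  ∷ ( r₁≢r₃ ∘ cong proj₁ , f≢c₃ ∘ cong proj₂ ,
    subst₂ _≢_ (sym (hamming-≢≢ r₁≢r₃ c₂≢c₃)) (sym (hamming-≡≢ r₃ f≢c₃)) (λ ()))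
  ∷ []

triple-separatingPair : 4 ≤ p → 4 ≤ q → (w₁ w₂ w₃ : Fin p × Fin q) →
                        SeparatingPair (w₁ ∷ w₂ ∷ w₃ ∷ [])
triple-separatingPair 4≤p 4≤q (r₁ , c₁) (r₂ , c₂) (r₃ , c₃)
  with distinct⊎coveredByTwo (≤-trans (s≤s (s≤s z≤n)) 4≤p) r₁ r₂ r₃
     | distinct⊎coveredByTwo (≤-trans (s≤s (s≤s z≤n)) 4≤q) c₁ c₂ c₃
... | inj₂ rows | _ = rowsCoveredByTwo⇒separatingPair rows (length<⇒∃∉ (c₁ ∷ c₂ ∷ c₃ ∷ []) 4≤q)
... | inj₁ _ | inj₂ columns = columnsCoveredByTwo⇒separatingPair columns (length<⇒∃∉ (r₁ ∷ r₂ ∷ r₃ ∷ []) 4≤p)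
... | inj₁ (r₁≢r₂ , r₁≢r₃ , r₂≢r₃) | inj₁ (c₁≢c₂ , _ , c₂≢c₃) =
  transversal⇒separatingPair r₁≢r₂ r₁≢r₃ r₂≢r₃ c₁≢c₂ c₂≢c₃ (proj₂ (length<⇒∃∉ (c₁ ∷ c₂ ∷ c₃ ∷ []) 4≤q))

withinTriple⇒¬distanceEqualizer :
  4 ≤ p → 4 ≤ q → {D : List (Fin p × Fin q)} (w₁ w₂ w₃ : Fin p × Fin q) →
  D ⊆ w₁ ∷ w₂ ∷ w₃ ∷ [] → ¬ IsDistanceEqualizer (K p □ K q) D
withinTriple⇒¬distanceEqualizer 4≤p 4≤q w₁ w₂ w₃ D⊆ =
  separatingPair⇒¬distanceEqualizer (separatingPair-⊆ D⊆ (triple-separatingPair 4≤p 4≤q w₁ w₂ w₃))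

distanceEqualizer-length≥4 : 4 ≤ p → 4 ≤ q → (D : List (Fin p × Fin q)) →
                             IsDistanceEqualizer (K p □ K q) D → 4 ≤ length D
distanceEqualizer-length≥4 4≤p@(s≤s _) 4≤q@(s≤s _) [] equalizer =
  ⊥-elim (withinTriple⇒¬distanceEqualizer 4≤p 4≤q (zero , zero) (zero , zero) (zero , zero) (λ ()) equalizer)
distanceEqualizer-length≥4 4≤p 4≤q (w ∷ []) equalizer =
  ⊥-elim (withinTriple⇒¬distanceEqualizer 4≤p 4≤q w w w (λ { (here e) → here e }) equalizer)
distanceEqualizer-length≥4 4≤p 4≤q (w₁ ∷ w₂ ∷ []) equalizer =
  ⊥-elim (withinTriple⇒¬distanceEqualizer 4≤p 4≤q w₁ w₂ w₂
           (λ { (here e) → here e ; (there (here e)) → there (here e) }) equalizer)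
distanceEqualizer-length≥4 4≤p 4≤q (w₁ ∷ w₂ ∷ w₃ ∷ []) equalizer =
  ⊥-elim (withinTriple⇒¬distanceEqualizer 4≤p 4≤q w₁ w₂ w₃ (λ w∈ → w∈) equalizer)
distanceEqualizer-length≥4 _ _ (_ ∷ _ ∷ _ ∷ _ ∷ _) _ = s≤s (s≤s (s≤s (s≤s z≤n)))

column : Fin q → List (Fin p × Fin q)
column c = tabulate (_, c)

column-unique : (c : Fin q) → Unique (column {p = p} c)
column-unique c = tabulate⁺ (cong proj₁)

column-isDistanceEqualizer : 3 ≤ p → (c : Fin q) → IsDistanceEqualizer (K p □ K q) (column c)
column-isDistanceEqualizer 3≤p c (a , b) (a' , b') x∉ y∉ _
  with r , r∉ ← length<⇒∃∉ (a ∷ a' ∷ []) 3≤p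
  with r≢a ∷ r≢a' ∷ [] ← ¬Any⇒All¬ _ r∉ =
  (r , c) , ∈-tabulate⁺ r , 2 ,
  hamming≡⇒dist (hamming-≢≢ (≢-sym r≢a) (off-column x∉)) ,
  hamming≡⇒dist (hamming-≢≢ (≢-sym r≢a') (off-column y∉))
  where
  off-column : ∀ {r b} → (r , b) ∉ column c → b ≢ c
  off-column {r} r,b∉ refl = r,b∉ (∈-tabulate⁺ r)

mainTheorem7 : (m : ℕ) → 4 ≤ m → EquidistantDimension (K 4 □ K m) 4
mainTheorem7 (suc m) 4≤m =
  (column zero , column-unique zero , column-isDistanceEqualizer (s≤s (s≤s (s≤s z≤n))) zero , refl) ,
  λ D _ → distanceEqualizer-length≥4 ≤-refl 4≤m D
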